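{- For every integer $n\ge 2$, \[ N(n) := \max_{\pi,\rho\in\Pi(n),\ \pi\neq\rho} |S_{\mathrm{out}}(\pi)\cap S_{\mathrm{out}}(\rho)| = 2^{n-1}. \]
   Context: $\Pi(n)$ denotes the set of permutations of $\{1,\dots,n\}$, each regarded as a sequence $\pi=(\pi_1,\dots,\pi_n)$. A TDRL operation on $\pi$ is specified by a binary pattern $b\in\{0,1\}^n$. Its result is the concatenation of the subsequence $(\pi_i : b_i=1)$ with the subsequence $(\pi_i : b_i=0)$, each taken with indices in increasing order. $S_{\mathrm{out}}(\pi)$ is the set of all sequences obtainable from $\pi$ by one TDRL operation. -}

module Defs where

open import Data.Bool using (Bool; true; false)
open import Data.Nat using (ℕ; zero; suc)
open import Data.Fin using (Fin)
import Data.Fin.Properties as FinP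
open import Data.Vec using (Vec; []; _∷_; toList)
open import Data.List using (List; []; _∷_; _++_; map; concatMap; filter; deduplicate; length)
import Data.List.Properties as ListP
open import Data.List.Relation.Unary.Unique.Propositional using (Unique)
open import Relation.Binary.Definitions using (DecidableEquality)

-- Sequences of labels.  Labels {1,…,n} are represented by Fin n (i.e. 0,…,n-1).
Seq : ℕ → Set
Seq n = List (Fin n)

_≟S_ : ∀ {n} → DecidableEquality (Seq n)
_≟S_ = ListP.≡-dec FinP._≟_

IsPerm : ∀ {n} → Vec (Fin n) n → Set
IsPerm π = Unique (toList π)

-- all binary patterns b ∈ {0,1}^m  (true = 1, false = 0)
patterns : (m : ℕ) → List (Vec Bool m)
patterns zero = [] ∷ []
patterns (suc m) = concatMap (λ b → (true ∷ b) ∷ (false ∷ b) ∷ []) (patterns m)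

ones zeros : ∀ {A : Set} {m} → Vec A m → Vec Bool m → List A
ones [] [] = []
ones (x ∷ xs) (true ∷ bs) = x ∷ ones xs bs
ones (x ∷ xs) (false ∷ bs) = ones xs bs
zeros [] [] = []
zeros (x ∷ xs) (true ∷ bs) = zeros xs bs
zeros (x ∷ xs) (false ∷ bs) = x ∷ zeros xs bs

tdrl : ∀ {A : Set} {m} → Vec A m → Vec Bool m → List A
tdrl π b = ones π b ++ zeros π b

-- S_out(π), as a list (possibly with repetitions) of all TDRL results
Sout : ∀ {n} → Vec (Fin n) n → List (Seq n)
Sout {n} π = map (tdrl π) (patterns n)

commonOut : ∀ {n} → Vec (Fin n) n → Vec (Fin n) n → ℕ
commonOut π ρ =
  length (filter (λ σ → σ ∈? Sout ρ) (deduplicate _≟S_ (Sout π)))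
  where open import Data.List.Membership.DecPropositional _≟S_ using (_∈?_)

module Submission where

-- Call σ a TDRL result of a duplicate-free list zs if σ = l ++ r for an
-- interleaving (l , r) of zs; S_out(π) consists of the TDRL results of π.
--
-- Upper bound, by induction on the common length m of two distinct orderings
-- xs, ys of one set.  For m ≥ 3 some x keeps them distinct after deletion, and
-- deleting x sends the shared results to shared results of the shorter
-- orderings.  This map is at most two-to-one (the fibre lemma): choose zs
-- among xs, ys with delete x σ ≠ delete x zs; a TDRL result of zs other than
-- zs itself has a unique decomposition, so the halves of delete x σ are
-- fixed, and σ is recovered from them and the side of the cut on which x
-- lies.  Hence at most 2 · 2^(m-2) shared results; m ≤ 2 is counted directly.
--
-- Lower bound: for π = 0 1 2 … and ρ = 1 0 2 …, pattern b(¬b)c on π and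
-- pattern (¬b)bc on ρ give the same result, and distinct (b , c) give distinct
-- results, so 2^(n-1) results are shared.

open import Defs
open import Data.Nat using (ℕ; zero; suc; _≤_; _<_; _+_; _^_; _∸_; z≤n; s≤s)
open import Data.Nat.Properties using (module ≤-Reasoning; ≤-antisym; ≤-trans; ≤-reflexive; <-irrefl; +-mono-≤; +-identityʳ; suc-injective)
open import Data.Bool using (Bool; true; false; not)
open import Data.Bool.Properties using () renaming (_≟_ to _≟B_)
open import Data.Fin using (Fin) renaming (zero to fzero; suc to fsuc)
import Data.Fin.Properties as FinP
open import Data.Vec using (Vec; []; _∷_; toList; tabulate)
open import Data.Vec.Properties using (length-toList; toList-injective)
import Data.Vec.Properties as Vec
open import Data.Vec.Relation.Binary.Equality.Cast using (cast-is-id)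
open import Data.List using (List; []; _∷_; _++_; map; length; filter; deduplicate; allFin)
open import Data.List.Properties using (∷-injectiveˡ; ∷-injectiveʳ; filter-++; filter-accept; filter-reject; filter-all; filter-notAll; length-++; length-map; length-tabulate)
import Data.List.Properties as ListP
import Data.List as List
open import Data.List.Membership.Propositional using (_∈_; _∉_; find)
open import Data.List.Membership.Propositional.Properties using (∈-++⁺ˡ; ∈-++⁺ʳ; ∈-++⁻; ∈-concatMap⁺; ∈-map⁺; ∈-map⁻; ∈-filter⁺; ∈-filter⁻; ∈-deduplicate⁺; ∈-deduplicate⁻; ∈-allFin; ∈-tabulate⁻)
import Data.List.Membership.DecPropositional as DecMembership
open import Data.List.Relation.Unary.Any using (Any; here; there; any?; tail)
import Data.List.Relation.Unary.Any as Any
open import Data.List.Relation.Unary.All as All using ([]; _∷_)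
open import Data.List.Relation.Unary.All.Properties using (¬Any⇒All¬)
open import Data.List.Relation.Unary.AllPairs using (_∷_)
open import Data.List.Relation.Unary.Unique.Propositional using (Unique; [])
open import Data.List.Relation.Unary.Unique.Propositional.Properties using (Unique[x∷xs]⇒x∉xs; filter⁺; map⁺; tabulate⁺) renaming (++⁺ to unique-++⁺)
open import Data.List.Relation.Unary.Unique.DecPropositional.Properties using (deduplicate-!)
open import Data.List.Relation.Binary.Sublist.Propositional using (_⊆_; []; _∷_; _∷ʳ_; ⊆-refl; ⊆-trans; lookup; minimum)
open import Data.List.Relation.Binary.Sublist.Propositional.Properties using (to-≋) renaming (++⁺ to ⊆-++⁺)
open import Data.List.Relation.Binary.Equality.Propositional using (≋⇒≡)
open import Data.List.Relation.Ternary.Interleaving.Propositional using (Interleaving; []; consˡ; consʳ; swap)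
open import Data.List.Relation.Ternary.Interleaving.Properties using (interleave-length)
open import Data.Product using (Σ-syntax; ∃-syntax; _×_; _,_; proj₁; proj₂; map₁; map₂)
import Data.Product.Properties as Product
open import Data.Sum using (_⊎_; inj₁; inj₂)
import Data.Sum
open import Data.Empty using (⊥; ⊥-elim)
open import Function using (_∘_; _⇔_; mk⇔; Equivalence)
open import Relation.Nullary using (¬_; Dec; yes; no; does; ¬?; _×-dec_)
open import Relation.Binary.Definitions using (DecidableEquality)
open import Relation.Binary.PropositionalEquality using (_≡_; _≢_; refl; sym; trans; cong; cong₂; subst; module ≡-Reasoning)

-- Deleting an element from a list, and counting by injections.

module Deletion {B : Set} (_≟_ : DecidableEquality B) where

  delete : B → List B → List B
  delete x = filter (λ y → ¬? (y ≟ x))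

  ∈-delete⁺ : ∀ {x y xs} → y ∈ xs → y ≢ x → y ∈ delete x xs
  ∈-delete⁺ = ∈-filter⁺ (λ y → ¬? (y ≟ _))

  ∈-delete⁻ : ∀ {x y xs} → y ∈ delete x xs → y ∈ xs × y ≢ x
  ∈-delete⁻ = ∈-filter⁻ (λ y → ¬? (y ≟ _))

  delete-other : ∀ {x y} xs → y ≢ x → delete x (y ∷ xs) ≡ y ∷ delete x xs
  delete-other _ = filter-accept (λ y → ¬? (y ≟ _))

  delete-self : ∀ {x} xs → delete x (x ∷ xs) ≡ delete x xs
  delete-self _ = filter-reject (λ y → ¬? (y ≟ _)) (λ x≢x → x≢x refl)

  delete-absent : ∀ {x xs} → x ∉ xs → delete x xs ≡ xs
  delete-absent {x} {xs} x∉xs =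
    filter-all (λ y → ¬? (y ≟ x)) (All.map (λ x≢y y≡x → x≢y (sym y≡x)) (¬Any⇒All¬ xs x∉xs))

  length-delete : ∀ {x xs} → Unique xs → x ∈ xs → length xs ≡ suc (length (delete x xs))
  length-delete {x} {y ∷ xs} u@(_ ∷ u′) x∈ with y ≟ x
  ... | yes refl = cong suc (cong length (sym (delete-absent (Unique[x∷xs]⇒x∉xs u))))
  ... | no y≢x   = cong suc (length-delete u′ (tail (λ x≡y → y≢x (sym x≡y)) x∈))

  length-delete< : ∀ {x xs} → x ∈ xs → length (delete x xs) < length xs
  length-delete< {x} {xs} x∈ = filter-notAll (λ y → ¬? (y ≟ x)) xs (Any.map (λ e ¬e → ¬e (sym e)) x∈)

  injection-length : ∀ {C : Set} (h : C → B) {L M} → Unique L →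
    (∀ {a b} → a ∈ L → b ∈ L → h a ≡ h b → a ≡ b) →
    (∀ {a} → a ∈ L → h a ∈ M) → length L ≤ length M
  injection-length h {[]} _ _ _ = z≤n
  injection-length h {a ∷ L} {M} u@(_ ∷ uL) inj into = ≤-trans (s≤s rest) (length-delete< (into (here refl)))
    where
    rest : length L ≤ length (delete (h a) M)
    rest = injection-length h uL (λ p q → inj (there p) (there q))
      (λ p → ∈-delete⁺ (into (there p))
                (λ e → Unique[x∷xs]⇒x∉xs u (subst (_∈ L) (inj (there p) (here refl) e) p)))

  subset-length : ∀ {L M} → Unique L → (∀ {a} → a ∈ L → a ∈ M) → length L ≤ length M
  subset-length u into = injection-length (λ a → a) u (λ _ _ e → e) into

tagged : ∀ {B : Set} → List B → List (B × Bool)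
tagged L = map (_, true) L ++ map (_, false) L

∈-tagged : ∀ {B : Set} {y : B} {L} → y ∈ L → ∀ b → (y , b) ∈ tagged L
∈-tagged p true = ∈-++⁺ˡ (∈-map⁺ (_, true) p)
∈-tagged {L = L} p false = ∈-++⁺ʳ (map (_, true) L) (∈-map⁺ (_, false) p)

length-tagged : ∀ {B : Set} (L : List B) → length (tagged L) ≡ length L + length L
length-tagged L = trans (length-++ (map (_, true) L)) (cong₂ _+_ (length-map _ L) (length-map _ L))

-- Sublists, interleavings and TDRL results (no decidable equality needed).

module Interleavings {A : Set} where

  private
    variable
      c : A
      xs zs l r l₁ l₂ r₁ r₂ m σ : List A

  ⊆-length : xs ⊆ zs → length xs ≡ length zs → xs ≡ zs
  ⊆-length τ eq = ≋⇒≡ (to-≋ eq τ)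

  -- Two sublists of a duplicate-free list that overlap in exactly one
  -- element c, the last of the first and the head of the second, combine:
  -- since c occurs once in zs, all of p precedes all of q.
  glue : (p q : List A) → Unique zs → p ++ c ∷ [] ⊆ zs → c ∷ q ⊆ zs → p ++ c ∷ q ⊆ zs
  glue []      q _       _          τ₂           = τ₂
  glue p       q (_ ∷ u) (z ∷ʳ τ₁)  (.z ∷ʳ τ₂)   = z ∷ʳ glue p q u τ₁ τ₂
  glue (a ∷ p) q (_ ∷ u) (refl ∷ τ₁) (_ ∷ʳ τ₂)   = refl ∷ glue p q u τ₁ τ₂
  glue (a ∷ p) q u       (_ ∷ʳ τ₁)  (refl ∷ τ₂)  =
    ⊥-elim (Unique[x∷xs]⇒x∉xs u (lookup τ₁ (∈-++⁺ʳ (a ∷ p) (here refl))))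
  glue (a ∷ p) q u       (refl ∷ τ₁) (refl ∷ τ₂) =
    ⊥-elim (Unique[x∷xs]⇒x∉xs u (lookup τ₁ (∈-++⁺ʳ p (here refl))))

  sublist-ext : Unique zs → l₁ ⊆ zs → l₂ ⊆ zs →
                (∀ {y} → y ∈ l₁ ⇔ y ∈ l₂) → l₁ ≡ l₂
  sublist-ext _       []          []          _    = refl
  sublist-ext (_ ∷ u) (z ∷ʳ τ₁)   (.z ∷ʳ τ₂)  same = sublist-ext u τ₁ τ₂ same
  sublist-ext u       (refl ∷ τ₁) (_ ∷ʳ τ₂)   same =
    ⊥-elim (Unique[x∷xs]⇒x∉xs u (lookup τ₂ (Equivalence.to same (here refl))))
  sublist-ext u       (_ ∷ʳ τ₁)   (refl ∷ τ₂) same =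
    ⊥-elim (Unique[x∷xs]⇒x∉xs u (lookup τ₁ (Equivalence.from same (here refl))))
  sublist-ext {zs = z ∷ zs} u (refl ∷ τ₁) (refl ∷ τ₂) same =
    cong (z ∷_) (sublist-ext (tailUnique u) τ₁ τ₂
      (mk⇔ (drop τ₁ (Equivalence.to same)) (drop τ₂ (Equivalence.from same))))
    where
    tailUnique : Unique (z ∷ zs) → Unique zs
    tailUnique (_ ∷ u′) = u′
    drop : ∀ {m₁ m₂} → m₁ ⊆ zs → (∀ {y} → y ∈ z ∷ m₁ → y ∈ z ∷ m₂) → ∀ {y} → y ∈ m₁ → y ∈ m₂
    drop τ f p = tail (λ y≡z → Unique[x∷xs]⇒x∉xs u (subst (_∈ zs) y≡z (lookup τ p))) (f (there p))

  interleaving-⊆ˡ : Interleaving l r zs → l ⊆ zs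
  interleaving-⊆ˡ []         = []
  interleaving-⊆ˡ (consˡ i)  = refl ∷ interleaving-⊆ˡ i
  interleaving-⊆ˡ (consʳ i)  = _ ∷ʳ interleaving-⊆ˡ i

  interleaving-⊆ʳ : Interleaving l r zs → r ⊆ zs
  interleaving-⊆ʳ = interleaving-⊆ˡ ∘ swap

  complement-unique : Unique zs → Interleaving l r₁ zs → Interleaving l r₂ zs → r₁ ≡ r₂
  complement-unique _       []         []         = refl
  complement-unique (_ ∷ u) (consˡ i₁) (consˡ i₂) = complement-unique u i₁ i₂
  complement-unique (_ ∷ u) (consʳ i₁) (consʳ i₂) = cong (_ ∷_) (complement-unique u i₁ i₂)
  complement-unique u       (consˡ i₁) (consʳ i₂) =
    ⊥-elim (Unique[x∷xs]⇒x∉xs u (lookup (interleaving-⊆ˡ i₂) (here refl)))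
  complement-unique u       (consʳ i₁) (consˡ i₂) =
    ⊥-elim (Unique[x∷xs]⇒x∉xs u (lookup (interleaving-⊆ˡ i₁) (here refl)))

  ++-cuts : (l₁ r₁ l₂ r₂ : List A) → l₁ ++ r₁ ≡ l₂ ++ r₂ →
    (∃[ m ] l₂ ≡ l₁ ++ m × r₁ ≡ m ++ r₂) ⊎ (∃[ m ] l₁ ≡ l₂ ++ m × r₂ ≡ m ++ r₁)
  ++-cuts []       r₁ l₂       r₂ eq = inj₁ (l₂ , refl , eq)
  ++-cuts (a ∷ l₁) r₁ []       r₂ eq = inj₂ (a ∷ l₁ , refl , sym eq)
  ++-cuts (a ∷ l₁) r₁ (b ∷ l₂) r₂ eq with ∷-injectiveˡ eq
  ... | refl = Data.Sum.map (map₂ (map₁ (cong (a ∷_)))) (map₂ (map₁ (cong (a ∷_))))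
                 (++-cuts l₁ r₁ l₂ r₂ (∷-injectiveʳ eq))

  record TDRL (zs σ : List A) : Set where
    constructor tdrl-by
    field
      front back   : List A
      interleaving : Interleaving front back zs
      result       : front ++ back ≡ σ
  open TDRL public using (front)

  -- If two decompositions of σ = l₁ ++ r₁ cut at different places, with the
  -- segment m between the cuts, then the two fronts glue along the first
  -- element of m into a sublist σ of zs; having the length of zs, σ ≡ zs.
  same-cut : Unique zs → Interleaving l₁ r₁ zs → Interleaving l₂ r₂ zs →
             l₂ ≡ l₁ ++ m → r₁ ≡ m ++ r₂ → l₁ ++ r₁ ≢ zs → l₁ ≡ l₂
  same-cut {l₁ = l₁} {m = []} _ _ _ refl _ _ = sym (ListP.++-identityʳ l₁)
  same-cut {zs = zs} {l₁ = l₁} {r₂ = r₂} {m = c ∷ m} u i₁ i₂ refl refl σ≢zs =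
    ⊥-elim (σ≢zs (⊆-length whole (trans (length-++ l₁) (sym (interleave-length i₁)))))
    where
    front⊆ : l₁ ++ c ∷ [] ⊆ zs
    front⊆ = ⊆-trans (⊆-++⁺ ⊆-refl (refl ∷ minimum m)) (interleaving-⊆ˡ i₂)
    whole : l₁ ++ c ∷ m ++ r₂ ⊆ zs
    whole = glue l₁ (m ++ r₂) u front⊆ (interleaving-⊆ʳ i₁)

  front-unique : Unique zs → (t₁ t₂ : TDRL zs σ) → σ ≢ zs → front t₁ ≡ front t₂
  front-unique u (tdrl-by l₁ r₁ i₁ refl) (tdrl-by l₂ r₂ i₂ eq) σ≢zs with ++-cuts l₁ r₁ l₂ r₂ (sym eq)
  ... | inj₁ (_ , l₂≡ , r₁≡) = same-cut u i₁ i₂ l₂≡ r₁≡ σ≢zs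
  ... | inj₂ (_ , l₁≡ , r₂≡) = sym (same-cut u i₂ i₁ l₁≡ r₂≡ (σ≢zs ∘ trans (sym eq)))

  tdrl-of-[] : TDRL [] σ → σ ≡ []
  tdrl-of-[] (tdrl-by _ _ [] refl) = refl

  tdrl-of-[a] : ∀ {a} → TDRL (a ∷ []) σ → σ ≡ a ∷ []
  tdrl-of-[a] (tdrl-by _ _ (consˡ []) refl) = refl
  tdrl-of-[a] (tdrl-by _ _ (consʳ []) refl) = refl

  tdrl-of-[a,b] : ∀ {a b} → TDRL (a ∷ b ∷ []) σ → σ ∈ (a ∷ b ∷ []) ∷ (b ∷ a ∷ []) ∷ []
  tdrl-of-[a,b] (tdrl-by _ _ (consˡ (consˡ [])) refl) = here refl
  tdrl-of-[a,b] (tdrl-by _ _ (consˡ (consʳ [])) refl) = here refl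
  tdrl-of-[a,b] (tdrl-by _ _ (consʳ (consˡ [])) refl) = there (here refl)
  tdrl-of-[a,b] (tdrl-by _ _ (consʳ (consʳ [])) refl) = here refl

  splits : List A → List (List A × List A)
  splits []       = ([] , []) ∷ []
  splits (z ∷ zs) = map (map₁ (z ∷_)) (splits zs) ++ map (map₂ (z ∷_)) (splits zs)

  splits-complete : Interleaving l r zs → (l , r) ∈ splits zs
  splits-complete []        = here refl
  splits-complete (consˡ i) = ∈-++⁺ˡ (∈-map⁺ (map₁ (_ ∷_)) (splits-complete i))
  splits-complete {zs = z ∷ zs} (consʳ i) =
    ∈-++⁺ʳ (map (map₁ (z ∷_)) (splits zs)) (∈-map⁺ (map₂ (z ∷_)) (splits-complete i))

  splits-sound : ∀ zs {p} → p ∈ splits zs → Interleaving (proj₁ p) (proj₂ p) zs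
  splits-sound []       (here refl) = []
  splits-sound (z ∷ zs) p∈ with ∈-++⁻ (map (map₁ (z ∷_)) (splits zs)) p∈
  ... | inj₁ q with ∈-map⁻ (map₁ (z ∷_)) q
  ...   | _ , q′ , refl = consˡ (splits-sound zs q′)
  splits-sound (z ∷ zs) p∈ | inj₂ q with ∈-map⁻ (map₂ (z ∷_)) q
  ...   | _ , q′ , refl = consʳ (splits-sound zs q′)

-- Orderings of a finite set and the upper bound.

module Orderings {A : Set} (_≟_ : DecidableEquality A) where

  open Deletion _≟_ public
  open Interleavings {A = A} public
  open DecMembership _≟_ using (_∈?_)

  private
    variable
      x c : A
      xs ys zs l r l₁ l₂ r₁ r₂ m σ σ₁ σ₂ : List A

  _≟L_ : DecidableEquality (List A)
  _≟L_ = ListP.≡-dec _≟_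

  interleaving-delete : ∀ x → Interleaving l r zs → Interleaving (delete x l) (delete x r) (delete x zs)
  interleaving-delete x []        = []
  interleaving-delete {zs = z ∷ _} x (consˡ i) with z ≟ x
  ... | yes _ = interleaving-delete x i
  ... | no  _ = consˡ (interleaving-delete x i)
  interleaving-delete {zs = z ∷ _} x (consʳ i) with z ≟ x
  ... | yes _ = interleaving-delete x i
  ... | no  _ = consʳ (interleaving-delete x i)

  tdrl-delete : ∀ x → TDRL zs σ → TDRL (delete x zs) (delete x σ)
  tdrl-delete x (tdrl-by l r i refl) =
    tdrl-by (delete x l) (delete x r) (interleaving-delete x i) (sym (filter-++ (λ y → ¬? (y ≟ x)) l r))

  ∈-from-delete : ∀ {x} → delete x l₁ ≡ delete x l₂ → (x ∈ l₁ → x ∈ l₂) → ∀ {y} → y ∈ l₁ → y ∈ l₂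
  ∈-from-delete {x = x} eq x-moves {y} p with y ≟ x
  ... | yes refl = x-moves p
  ... | no  y≢x  = proj₁ (∈-delete⁻ (subst (y ∈_) eq (∈-delete⁺ p y≢x)))

  -- Fibre lemma: TDRL results σ₁, σ₂ of zs that agree after deleting x are
  -- equal, provided the common deletion is not delete x zs and x lies in the
  -- fronts of both decompositions or in neither.  (The deleted decompositions
  -- are then equal by front-unique, and membership recovers the fronts.)
  fibre : ∀ {x} → Unique zs → (t₁ : TDRL zs σ₁) (t₂ : TDRL zs σ₂) →
          (x ∈ front t₁ ⇔ x ∈ front t₂) →
          delete x σ₁ ≡ delete x σ₂ → delete x σ₁ ≢ delete x zs → σ₁ ≡ σ₂
  fibre {zs = zs} {x = x} u (tdrl-by l₁ r₁ i₁ refl) (tdrl-by l₂ r₂ i₂ refl) x-side del-eq apart =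
    cong₂ _++_ fronts backs
    where
    deleted₂ : TDRL (delete x zs) (delete x (l₁ ++ r₁))
    deleted₂ = tdrl-by (delete x l₂) (delete x r₂) (interleaving-delete x i₂)
                 (trans (sym (filter-++ (λ y → ¬? (y ≟ x)) l₂ r₂)) (sym del-eq))
    fronts-deleted : delete x l₁ ≡ delete x l₂
    fronts-deleted = front-unique (filter⁺ (λ y → ¬? (y ≟ x)) u) (tdrl-delete x (tdrl-by l₁ r₁ i₁ refl))
                       deleted₂ apart
    fronts : l₁ ≡ l₂
    fronts = sublist-ext u (interleaving-⊆ˡ i₁) (interleaving-⊆ˡ i₂)
      (mk⇔ (∈-from-delete fronts-deleted (Equivalence.to x-side))
           (∈-from-delete (sym fronts-deleted) (Equivalence.from x-side)))
    backs : r₁ ≡ r₂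
    backs = complement-unique u i₁ (subst (λ l → Interleaving l r₂ zs) (sym fronts) i₂)

  -- On which side of the cut x lies is not a function of σ in general, so we
  -- decide it by searching all interleavings of zs.

  FrontDecomposition : A → List A → List A → Set
  FrontDecomposition x zs σ = Any (λ (l , r) → l ++ r ≡ σ × x ∈ l) (splits zs)

  front? : ∀ x zs σ → Dec (FrontDecomposition x zs σ)
  front? x zs σ = any? (λ (l , r) → ((l ++ r) ≟L σ) ×-dec (x ∈? l)) (splits zs)

  side : A → List A → List A → Bool
  side x zs σ = does (front? x zs σ)

  front-decomposition⁺ : (t : TDRL zs σ) → x ∈ front t → FrontDecomposition x zs σ
  front-decomposition⁺ (tdrl-by l r i eq) x∈ = Any.map (λ { refl → eq , x∈ }) (splits-complete i)

  front-decomposition⁻ : FrontDecomposition x zs σ → Σ[ t ∈ TDRL zs σ ] x ∈ front t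
  front-decomposition⁻ {zs = zs} f with find f
  ... | (l , r) , p∈ , eq , x∈ = tdrl-by l r (splits-sound zs p∈) eq , x∈

  same-side : TDRL zs σ₁ → TDRL zs σ₂ → side x zs σ₁ ≡ side x zs σ₂ →
              Σ[ t₁ ∈ TDRL zs σ₁ ] Σ[ t₂ ∈ TDRL zs σ₂ ] (x ∈ front t₁ ⇔ x ∈ front t₂)
  same-side {zs = zs} {σ₁ = σ₁} {σ₂ = σ₂} {x = x} t₁ t₂ eq with front? x zs σ₁ | front? x zs σ₂
  ... | yes f₁ | yes f₂ with front-decomposition⁻ f₁ | front-decomposition⁻ f₂
  ...   | t₁′ , x∈₁ | t₂′ , x∈₂ = t₁′ , t₂′ , mk⇔ (λ _ → x∈₂) (λ _ → x∈₁)
  same-side t₁ t₂ eq | no ¬f₁ | no ¬f₂ =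
    t₁ , t₂ , mk⇔ (⊥-elim ∘ ¬f₁ ∘ front-decomposition⁺ t₁) (⊥-elim ∘ ¬f₂ ∘ front-decomposition⁺ t₂)
  same-side t₁ t₂ () | yes _ | no _
  same-side t₁ t₂ () | no _  | yes _

  record DistinctOrderings (xs ys : List A) : Set where
    field
      xs-unique : Unique xs
      ys-unique : Unique ys
      xs⊆ys     : ∀ {y} → y ∈ xs → y ∈ ys
      ys⊆xs     : ∀ {y} → y ∈ ys → y ∈ xs
      distinct  : xs ≢ ys

  heads-differ : ∀ {x a c} xs ys → x ≢ a → x ≢ c → a ≢ c → delete x (a ∷ xs) ≢ delete x (c ∷ ys)
  heads-differ xs ys x≢a x≢c a≢c eq =
    a≢c (∷-injectiveˡ (trans (sym (delete-other xs (x≢a ∘ sym))) (trans eq (delete-other ys (x≢c ∘ sym)))))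

  -- Orderings of at least three elements stay distinct after deleting a
  -- suitable x: the common head if the heads agree, else an element that is
  -- neither head.
  distinguishing : DistinctOrderings xs ys → 3 ≤ length xs → ∃[ x ] x ∈ xs × delete x xs ≢ delete x ys
  distinguishing {xs = a ∷ _} {ys = []} d _ with DistinctOrderings.xs⊆ys d (here refl)
  ... | ()
  distinguishing {xs = a ∷ b ∷ r ∷ xs} {ys = c ∷ ys} d (s≤s (s≤s (s≤s z≤n))) with a ≟ c
  ... | yes refl = a , here refl , λ eq → distinct (cong (a ∷_)
          (begin
            xs′                ≡⟨ delete-absent (Unique[x∷xs]⇒x∉xs xs-unique) ⟨
            delete a xs′       ≡⟨ delete-self xs′ ⟨
            delete a (a ∷ xs′) ≡⟨ eq ⟩
            delete a (a ∷ ys)  ≡⟨ delete-self ys ⟩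
            delete a ys        ≡⟨ delete-absent (Unique[x∷xs]⇒x∉xs ys-unique) ⟩
            ys                 ∎))
    where
    open DistinctOrderings d
    open ≡-Reasoning
    xs′ = b ∷ r ∷ xs
  ... | no a≢c with DistinctOrderings.xs-unique d | b ≟ c
  ...   | (a≢b ∷ a≢r ∷ _) ∷ (b≢r ∷ _) ∷ _ | yes refl =
          r , there (there (here refl)) , heads-differ _ _ (a≢r ∘ sym) (b≢r ∘ sym) a≢c
  ...   | (a≢b ∷ _) ∷ _                    | no b≢c   =
          b , there (here refl) , heads-differ _ _ (a≢b ∘ sym) b≢c a≢c

  deletion-orderings : ∀ {x} → DistinctOrderings xs ys → delete x xs ≢ delete x ys →
                       DistinctOrderings (delete x xs) (delete x ys)
  deletion-orderings {x = x} d apart = record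
    { xs-unique = filter⁺ (λ y → ¬? (y ≟ x)) xs-unique
    ; ys-unique = filter⁺ (λ y → ¬? (y ≟ x)) ys-unique
    ; xs⊆ys     = λ p → let (p′ , y≢x) = ∈-delete⁻ p in ∈-delete⁺ (xs⊆ys p′) y≢x
    ; ys⊆xs     = λ p → let (p′ , y≢x) = ∈-delete⁻ p in ∈-delete⁺ (ys⊆xs p′) y≢x
    ; distinct  = apart
    }
    where open DistinctOrderings d

  Shared : List A → List A → List A → Set
  Shared xs ys σ = TDRL xs σ × TDRL ys σ

  module OnLists = Deletion _≟L_
  module OnTaggedLists = Deletion (Product.≡-dec _≟L_ _≟B_)

  -- The induction step: deleting a distinguishing element x is at most
  -- two-to-one on shared results.
  module Halving {xs ys} (d : DistinctOrderings xs ys) {x} (apart : delete x xs ≢ delete x ys) where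
    open DistinctOrderings d

    -- the ordering against which a shared σ with delete x σ ≡ τ is classified
    reference : List A → List A
    reference τ with τ ≟L delete x xs
    ... | yes _ = ys
    ... | no  _ = xs

    reference-apart : ∀ τ → τ ≢ delete x (reference τ)
    reference-apart τ with τ ≟L delete x xs
    ... | yes τ≡ = λ τ≡′ → apart (trans (sym τ≡) τ≡′)
    ... | no  τ≢ = τ≢

    reference-unique : ∀ τ → Unique (reference τ)
    reference-unique τ with τ ≟L delete x xs
    ... | yes _ = ys-unique
    ... | no  _ = xs-unique

    reference-source : ∀ τ {σ} → Shared xs ys σ → TDRL (reference τ) σ
    reference-source τ (t , t′) with τ ≟L delete x xs
    ... | yes _ = t′
    ... | no  _ = t

    classify : List A → List A × Bool
    classify σ = delete x σ , side x (reference (delete x σ)) σ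

    classify-injective : ∀ {σ₁ σ₂} → Shared xs ys σ₁ → Shared xs ys σ₂ →
                         classify σ₁ ≡ classify σ₂ → σ₁ ≡ σ₂
    classify-injective {σ₁} {σ₂} s₁ s₂ eq =
      let (t₁ , t₂ , x-side) = same-side (reference-source τ s₁) (reference-source τ s₂) side-eq
      in fibre (reference-unique τ) t₁ t₂ x-side del-eq (reference-apart τ)
      where
      τ = delete x σ₁
      del-eq : delete x σ₁ ≡ delete x σ₂
      del-eq = cong proj₁ eq
      side-eq : side x (reference τ) σ₁ ≡ side x (reference τ) σ₂
      side-eq = trans (cong proj₂ eq) (cong (λ τ′ → side x (reference τ′) σ₂) (sym del-eq))

    halve : ∀ {L} → Unique L → (∀ {σ} → σ ∈ L → Shared xs ys σ) →
            Σ[ L′ ∈ List (List A) ] Unique L′ × (∀ {τ} → τ ∈ L′ → Shared (delete x xs) (delete x ys) τ)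
              × length L ≤ length L′ + length L′
    halve {L} uL shared = L′ , deduplicate-! _≟L_ (map (delete x) L) , shared′ ,
      ≤-trans (OnTaggedLists.injection-length classify uL
                 (λ p q → classify-injective (shared p) (shared q))
                 (λ p → ∈-tagged (∈-deduplicate⁺ _≟L_ (∈-map⁺ (delete x) p)) _))
              (≤-reflexive (length-tagged L′))
      where
      L′ = deduplicate _≟L_ (map (delete x) L)
      shared′ : ∀ {τ} → τ ∈ L′ → Shared (delete x xs) (delete x ys) τ
      shared′ p with ∈-map⁻ (delete x) (∈-deduplicate⁻ _≟L_ (map (delete x) L) p)
      ... | _ , σ∈ , refl = Data.Product.map (tdrl-delete x) (tdrl-delete x) (shared σ∈)

  SharedBound : ℕ → Set
  SharedBound m = ∀ {xs ys} → length xs ≡ m → DistinctOrderings xs ys →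
                  ∀ {L} → Unique L → (∀ {σ} → σ ∈ L → Shared xs ys σ) → length L ≤ 2 ^ (m ∸ 1)

  shared-bound-step : ∀ m → SharedBound (suc (suc m)) → SharedBound (suc (suc (suc m)))
  shared-bound-step m ih len d {L} uL shared
    with distinguishing d (subst (3 ≤_) (sym len) (s≤s (s≤s (s≤s z≤n))))
  ... | x , x∈xs , apart with Halving.halve d apart uL shared
  ...   | L′ , uL′ , shared′ , L≤ = begin
    length L               ≤⟨ L≤ ⟩
    length L′ + length L′  ≤⟨ +-mono-≤ ih′ ih′ ⟩
    2 ^ suc m + 2 ^ suc m  ≡⟨ cong (2 ^ suc m +_) (+-identityʳ (2 ^ suc m)) ⟨
    2 ^ suc (suc m)        ∎
    where
    open ≤-Reasoning
    ih′ : length L′ ≤ 2 ^ suc m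
    ih′ = ih (suc-injective (trans (sym (length-delete (DistinctOrderings.xs-unique d) x∈xs)) len))
             (deletion-orderings d apart) uL′ shared′

  -- induction on m; lists of length ≤ 2 have at most 2^(m-1) TDRL results at all
  shared-bound : ∀ m → SharedBound m
  shared-bound 0 {xs = []} _ _ uL shared =
    OnLists.subset-length {M = [] ∷ []} uL (λ p → here (tdrl-of-[] (proj₁ (shared p))))
  shared-bound 1 {xs = a ∷ []} _ _ uL shared =
    OnLists.subset-length {M = (a ∷ []) ∷ []} uL (λ p → here (tdrl-of-[a] (proj₁ (shared p))))
  shared-bound 2 {xs = _ ∷ _ ∷ []} _ _ uL shared =
    OnLists.subset-length uL (λ p → tdrl-of-[a,b] (proj₁ (shared p)))
  shared-bound (suc (suc (suc m))) = shared-bound-step m (shared-bound (suc (suc m)))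

-- Connection with the definitions of Defs.

ones-zeros-interleave : ∀ {A : Set} {m} (v : Vec A m) (b : Vec Bool m) →
                        Interleaving (ones v b) (zeros v b) (toList v)
ones-zeros-interleave []      []          = []
ones-zeros-interleave (x ∷ v) (true ∷ b)  = consˡ (ones-zeros-interleave v b)
ones-zeros-interleave (x ∷ v) (false ∷ b) = consʳ (ones-zeros-interleave v b)

ones-injective : ∀ {A : Set} {m} (v : Vec A m) → Unique (toList v) → ∀ {b c} → ones v b ≡ ones v c → b ≡ c
ones-injective []      _       {[]}        {[]}        _  = refl
ones-injective (x ∷ v) (_ ∷ u) {true ∷ b}  {true ∷ c}  eq = cong (true ∷_) (ones-injective v u (∷-injectiveʳ eq))
ones-injective (x ∷ v) (_ ∷ u) {false ∷ b} {false ∷ c} eq = cong (false ∷_) (ones-injective v u eq)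
ones-injective (x ∷ v) u       {true ∷ b}  {false ∷ c} eq =
  ⊥-elim (Unique[x∷xs]⇒x∉xs u (lookup (Interleavings.interleaving-⊆ˡ (ones-zeros-interleave v c))
                                        (subst (x ∈_) eq (here refl))))
ones-injective (x ∷ v) u       {false ∷ b} {true ∷ c}  eq =
  ⊥-elim (Unique[x∷xs]⇒x∉xs u (lookup (Interleavings.interleaving-⊆ˡ (ones-zeros-interleave v b))
                                        (subst (x ∈_) (sym eq) (here refl))))

patterns-complete : ∀ m (b : Vec Bool m) → b ∈ patterns m
patterns-complete zero    []          = here refl
patterns-complete (suc m) (true ∷ b)  =
  ∈-concatMap⁺ (λ b → (true ∷ b) ∷ (false ∷ b) ∷ []) (Any.map (λ { refl → here refl }) (patterns-complete m b))
patterns-complete (suc m) (false ∷ b) =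
  ∈-concatMap⁺ (λ b → (true ∷ b) ∷ (false ∷ b) ∷ []) (Any.map (λ { refl → there (here refl) }) (patterns-complete m b))

module _ {n : ℕ} where
  open Orderings (FinP._≟_ {n})
  open DecMembership (_≟S_ {n}) using () renaming (_∈?_ to _∈S?_)
  open DecMembership (FinP._≟_ {n}) using (_∈?_)

  sout-tdrl : (π : Vec (Fin n) n) → ∀ {σ} → σ ∈ Sout π → TDRL (toList π) σ
  sout-tdrl π p with ∈-map⁻ (tdrl π) p
  ... | b , _ , refl = tdrl-by (ones π b) (zeros π b) (ones-zeros-interleave π b) refl

  -- the shared sequences counted by commonOut: commonOut π ρ is, by
  -- definition, length (common π ρ)
  common : Vec (Fin n) n → Vec (Fin n) n → List (Seq n)
  common π ρ = filter (λ σ → σ ∈S? Sout ρ) (deduplicate _≟S_ (Sout π))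

  common-unique : ∀ π ρ → Unique (common π ρ)
  common-unique π ρ = filter⁺ (λ σ → σ ∈S? Sout ρ) (deduplicate-! _≟S_ (Sout π))

  ∈-common⁻ : ∀ π ρ {σ} → σ ∈ common π ρ → σ ∈ Sout π × σ ∈ Sout ρ
  ∈-common⁻ π ρ p with ∈-filter⁻ (λ σ → σ ∈S? Sout ρ) p
  ... | p′ , σ∈ρ = ∈-deduplicate⁻ _≟S_ (Sout π) p′ , σ∈ρ

  ∈-common⁺ : ∀ π ρ {σ} → σ ∈ Sout π → σ ∈ Sout ρ → σ ∈ common π ρ
  ∈-common⁺ π ρ σ∈π σ∈ρ = ∈-filter⁺ (λ σ → σ ∈S? Sout ρ) (∈-deduplicate⁺ _≟S_ σ∈π) σ∈ρ

  complete : ∀ {xs} → Unique xs → length xs ≡ n → ∀ y → y ∈ xs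
  complete {xs} u len y with y ∈? xs
  ... | yes y∈ = y∈
  ... | no  y∉ = ⊥-elim (<-irrefl refl (begin-strict
    n                               ≡⟨ len ⟨
    length xs                       ≤⟨ subset-length u avoid-y ⟩
    length (delete y (allFin n))    <⟨ length-delete< (∈-allFin y) ⟩
    length (allFin n)               ≡⟨ length-tabulate (λ i → i) ⟩
    n                               ∎))
    where
    open ≤-Reasoning
    -- without y, xs fits into the other n - 1 labels
    avoid-y : ∀ {a} → a ∈ xs → a ∈ delete y (allFin n)
    avoid-y p = ∈-delete⁺ (∈-allFin _) (λ e → y∉ (subst (_∈ xs) e p))

  perm-orderings : ∀ {π ρ : Vec (Fin n) n} → IsPerm π → IsPerm ρ → π ≢ ρ →
                   DistinctOrderings (toList π) (toList ρ)
  perm-orderings {π} {ρ} π-perm ρ-perm π≢ρ = record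
    { xs-unique = π-perm
    ; ys-unique = ρ-perm
    ; xs⊆ys     = λ {y} _ → complete ρ-perm (length-toList ρ) y
    ; ys⊆xs     = λ {y} _ → complete π-perm (length-toList π) y
    ; distinct  = λ eq → π≢ρ (trans (sym (cast-is-id refl π)) (toList-injective refl π ρ eq))
    }

  upper-bound : (π ρ : Vec (Fin n) n) → IsPerm π → IsPerm ρ → ¬ (π ≡ ρ) → commonOut π ρ ≤ 2 ^ (n ∸ 1)
  upper-bound π ρ π-perm ρ-perm π≢ρ =
    shared-bound n (length-toList π) (perm-orderings π-perm ρ-perm π≢ρ) (common-unique π ρ)
      (λ p → let (σ∈π , σ∈ρ) = ∈-common⁻ π ρ p in sout-tdrl π σ∈π , sout-tdrl ρ σ∈ρ)

-- The extremal pair.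

vectors : ∀ m → List (Vec Bool m)
vectors zero    = [] ∷ []
vectors (suc m) = map (true ∷_) (vectors m) ++ map (false ∷_) (vectors m)

length-vectors : ∀ m → length (vectors m) ≡ 2 ^ m
length-vectors zero    = refl
length-vectors (suc m) = begin
  length (map (true ∷_) (vectors m) ++ map (false ∷_) (vectors m)) ≡⟨ length-++ (map (true ∷_) (vectors m)) ⟩
  length (map (true ∷_) (vectors m)) + length (map (false ∷_) (vectors m))
    ≡⟨ cong₂ _+_ (length-map _ (vectors m)) (length-map _ (vectors m)) ⟩
  length (vectors m) + length (vectors m)                          ≡⟨ cong₂ _+_ (length-vectors m) (length-vectors m) ⟩
  2 ^ m + 2 ^ m                                                    ≡⟨ cong (2 ^ m +_) (+-identityʳ (2 ^ m)) ⟨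
  2 ^ suc m                                                        ∎
  where open ≡-Reasoning

vectors-unique : ∀ m → Unique (vectors m)
vectors-unique zero    = [] ∷ []
vectors-unique (suc m) =
  unique-++⁺ (map⁺ Vec.∷-injectiveʳ (vectors-unique m)) (map⁺ Vec.∷-injectiveʳ (vectors-unique m)) different-heads
  where
  different-heads : ∀ {w} → w ∈ map (true ∷_) (vectors m) × w ∈ map (false ∷_) (vectors m) → ⊥
  different-heads (p , q) with ∈-map⁻ (true ∷_) p | ∈-map⁻ (false ∷_) q
  ... | _ , _ , refl | _ , _ , ()

prefix-before : ∀ {A : Set} {y : A} (p₁ p₂ : List A) {q₁ q₂} → y ∉ p₁ → y ∉ p₂ →
                p₁ ++ y ∷ q₁ ≡ p₂ ++ y ∷ q₂ → p₁ ≡ p₂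
prefix-before []       []       _   _   _  = refl
prefix-before []       (a ∷ p₂) _   y∉₂ eq = ⊥-elim (y∉₂ (here (∷-injectiveˡ eq)))
prefix-before (a ∷ p₁) []       y∉₁ _   eq = ⊥-elim (y∉₁ (here (sym (∷-injectiveˡ eq))))
prefix-before (a ∷ p₁) (b ∷ p₂) y∉₁ y∉₂ eq =
  cong₂ _∷_ (∷-injectiveˡ eq) (prefix-before p₁ p₂ (y∉₁ ∘ there) (y∉₂ ∘ there) (∷-injectiveʳ eq))

unique-∷ : ∀ {A : Set} {a : A} {xs} → a ∉ xs → Unique xs → Unique (a ∷ xs)
unique-∷ {xs = xs} a∉ u = ¬Any⇒All¬ xs a∉ ∷ u

toList-tabulate : ∀ {A : Set} {m} (f : Fin m → A) → toList (tabulate f) ≡ List.tabulate f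
toList-tabulate {m = zero}  f = refl
toList-tabulate {m = suc m} f = cong (f fzero ∷_) (toList-tabulate (f ∘ fsuc))

module ExtremalPair (k : ℕ) where
  module OnSequences = Deletion (_≟S_ {suc (suc k)})

  rest : Vec (Fin (suc (suc k))) k
  rest = tabulate (fsuc ∘ fsuc)

  π ρ : Vec (Fin (suc (suc k))) (suc (suc k))
  π = fzero ∷ fsuc fzero ∷ rest
  ρ = fsuc fzero ∷ fzero ∷ rest

  rest-entries : ∀ {y} → y ∈ toList rest → ∃[ i ] y ≡ fsuc (fsuc i)
  rest-entries p = ∈-tabulate⁻ (subst (_ ∈_) (toList-tabulate (fsuc ∘ fsuc)) p)

  rest-unique : Unique (toList rest)
  rest-unique = subst Unique (sym (toList-tabulate (fsuc ∘ fsuc)))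
                  (tabulate⁺ (FinP.suc-injective ∘ FinP.suc-injective))

  0∉rest : fzero ∉ toList rest
  0∉rest p with rest-entries p
  ... | _ , ()

  1∉rest : fsuc fzero ∉ toList rest
  1∉rest p with rest-entries p
  ... | _ , ()

  π-perm : IsPerm π
  π-perm = unique-∷ (λ { (here ()) ; (there p) → 0∉rest p }) (unique-∷ 1∉rest rest-unique)

  ρ-perm : IsPerm ρ
  ρ-perm = unique-∷ (λ { (here ()) ; (there p) → 1∉rest p }) (unique-∷ 0∉rest rest-unique)

  -- pattern b (¬b) c on π and pattern (¬b) b c on ρ select the same entries
  shared-sequence : Vec Bool (suc k) → Seq (suc (suc k))
  shared-sequence (b ∷ c) = tdrl π (b ∷ not b ∷ c)

  swap-first-two : ∀ b c → tdrl π (b ∷ not b ∷ c) ≡ tdrl ρ (not b ∷ b ∷ c)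
  swap-first-two true  c = refl
  swap-first-two false c = refl

  ones-rest-⊆ : ∀ {y} c → y ∈ ones rest c → y ∈ toList rest
  ones-rest-⊆ c = lookup (Interleavings.interleaving-⊆ˡ (ones-zeros-interleave rest c))

  -- the first entry gives b; the entries before the other of 0, 1 give c
  shared-sequence-injective : ∀ {u v} → shared-sequence u ≡ shared-sequence v → u ≡ v
  shared-sequence-injective {true ∷ c} {true ∷ c′} eq = cong (true ∷_) (ones-injective rest rest-unique
    (prefix-before (ones rest c) (ones rest c′) (1∉rest ∘ ones-rest-⊆ c) (1∉rest ∘ ones-rest-⊆ c′) (∷-injectiveʳ eq)))
  shared-sequence-injective {false ∷ c} {false ∷ c′} eq = cong (false ∷_) (ones-injective rest rest-unique
    (prefix-before (ones rest c) (ones rest c′) (0∉rest ∘ ones-rest-⊆ c) (0∉rest ∘ ones-rest-⊆ c′) (∷-injectiveʳ eq)))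
  shared-sequence-injective {true ∷ _}  {false ∷ _} eq with ∷-injectiveˡ eq
  ... | ()
  shared-sequence-injective {false ∷ _} {true ∷ _}  eq with ∷-injectiveˡ eq
  ... | ()

  shared-sequence-common : ∀ u → shared-sequence u ∈ common π ρ
  shared-sequence-common (b ∷ c) = ∈-common⁺ π ρ
    (∈-map⁺ (tdrl π) (patterns-complete _ (b ∷ not b ∷ c)))
    (subst (_∈ Sout ρ) (sym (swap-first-two b c)) (∈-map⁺ (tdrl ρ) (patterns-complete _ (not b ∷ b ∷ c))))

  lower-bound : 2 ^ suc k ≤ commonOut π ρ
  lower-bound = subst (_≤ commonOut π ρ) (length-vectors (suc k))
    (OnSequences.injection-length shared-sequence (vectors-unique (suc k))
      (λ _ _ → shared-sequence-injective) (λ {u} _ → shared-sequence-common u))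

  extremal : Σ[ π ∈ Vec (Fin (suc (suc k))) (suc (suc k)) ] Σ[ ρ ∈ Vec (Fin (suc (suc k))) (suc (suc k)) ]
               (IsPerm π × IsPerm ρ × ¬ (π ≡ ρ) × commonOut π ρ ≡ 2 ^ suc k)
  extremal = π , ρ , π-perm , ρ-perm , (λ ()) , ≤-antisym (upper-bound π ρ π-perm ρ-perm (λ ())) lower-bound

theorem3 : (n : ℕ) → 2 ≤ n →
    ((π ρ : Vec (Fin n) n) → IsPerm π → IsPerm ρ → ¬ (π ≡ ρ) →
       commonOut π ρ ≤ 2 ^ (n ∸ 1))
    ×
    (Σ[ π ∈ Vec (Fin n) n ] Σ[ ρ ∈ Vec (Fin n) n ]
       (IsPerm π × IsPerm ρ × ¬ (π ≡ ρ) × commonOut π ρ ≡ 2 ^ (n ∸ 1)))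
theorem3 (suc zero) (s≤s ())
theorem3 (suc (suc k)) _ = upper-bound , ExtremalPair.extremal k
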